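{- Let ${\sf L}$ be any normal modal logic having the Craig interpolation property for both propositional variables and agents. Then the global consequence relation $\vdash_{\sf L}$ has the following restricted form of deductive interpolation: whenever $\phi\vdash_{\sf L}\psi$, there exists a formula $\delta$ such that $\phi\vdash_{\sf L}\delta$, $\delta\vdash_{\sf L}\psi$, $\mathrm{Var}(\delta)\subseteq\mathrm{Var}(\phi)\cap\mathrm{Var}(\psi)$ and $\mathrm{Ag}(\delta)\subseteq\mathrm{Ag}(\psi)$.
   Context: Language: formulas built from a countably infinite set of atoms with $\bot,\top,\neg,\wedge,\vee,\to$ and modalities $\Box_a,\Diamond_a$ for agents $a$ in a finite nonempty set $A$. $\mathrm{Var}(\phi)$ is the set of atoms in $\phi$, $\mathrm{Ag}(\phi)$ the set of agents $a$ with $\Box_a$ or $\Diamond_a$ occurring in $\phi$. A normal modal logic ${\sf L}$ is a set of formulas containing all classical tautologies and the axiom $\Box_a(\phi\to\psi)\to(\Box_a\phi\to\Box_a\psi)$ for each $a\in A$, and closed under modus ponens, necessitation ($\phi/\Box_a\phi$ for each $a$) and uniform substitution. Global consequence: $\Gamma\vdash_{\sf L}\psi$ iff $\psi$ belongs to the least set of formulas containing ${\sf L}\cup\Gamma$ and closed under modus ponens and necessitation for every $a\in A$. ${\sf L}$ has the Craig interpolation property for propositional variables and agents iff whenever $\phi\to\psi\in{\sf L}$ there is $\delta$ with $\phi\to\delta\in{\sf L}$, $\delta\to\psi\in{\sf L}$, $\mathrm{Var}(\delta)\subseteq\mathrm{Var}(\phi)\cap\mathrm{Var}(\psi)$ and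 $\mathrm{Ag}(\delta)\subseteq\mathrm{Ag}(\phi)\cap\mathrm{Ag}(\psi)$. -}

module Defs where

open import Data.Nat using (ℕ; suc)
open import Data.Fin using (Fin)
open import Data.Bool using (Bool; true; false; not; _∧_; _∨_)
open import Data.Product using (Σ; _×_)
open import Data.Sum using (_⊎_)
open import Data.Empty using (⊥)
open import Relation.Binary.PropositionalEquality using (_≡_)
open import Level using (Level; suc; _⊔_) renaming (zero to lzero)

data Form (Agent : Set) : Set where
  var  : ℕ → Form Agent
  ⊥'   : Form Agent
  ⊤'   : Form Agent
  ¬'_  : Form Agent → Form Agent
  _∧'_ : Form Agent → Form Agent → Form Agent
  _∨'_ : Form Agent → Form Agent → Form Agent
  _⇒_  : Form Agent → Form Agent → Form Agent
  □    : Agent → Form Agent → Form Agent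
  ◇    : Agent → Form Agent → Form Agent

infix 25 ¬'_
infixr 24 _∧'_
infixr 23 _∨'_
infixr 22 _⇒_

module _ {Agent : Set} where

  data _∈Var_ (p : ℕ) : Form Agent → Set where
    here : p ∈Var var p
    ¬∈   : ∀ {φ} → p ∈Var φ → p ∈Var (¬' φ)
    ∧ˡ   : ∀ {φ ψ} → p ∈Var φ → p ∈Var (φ ∧' ψ)
    ∧ʳ   : ∀ {φ ψ} → p ∈Var ψ → p ∈Var (φ ∧' ψ)
    ∨ˡ   : ∀ {φ ψ} → p ∈Var φ → p ∈Var (φ ∨' ψ)
    ∨ʳ   : ∀ {φ ψ} → p ∈Var ψ → p ∈Var (φ ∨' ψ)
    ⇒ˡ   : ∀ {φ ψ} → p ∈Var φ → p ∈Var (φ ⇒ ψ)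
    ⇒ʳ   : ∀ {φ ψ} → p ∈Var ψ → p ∈Var (φ ⇒ ψ)
    □∈   : ∀ {a φ} → p ∈Var φ → p ∈Var (□ a φ)
    ◇∈   : ∀ {a φ} → p ∈Var φ → p ∈Var (◇ a φ)

  data _∈Ag_ (a : Agent) : Form Agent → Set where
    ¬∈   : ∀ {φ} → a ∈Ag φ → a ∈Ag (¬' φ)
    ∧ˡ   : ∀ {φ ψ} → a ∈Ag φ → a ∈Ag (φ ∧' ψ)
    ∧ʳ   : ∀ {φ ψ} → a ∈Ag ψ → a ∈Ag (φ ∧' ψ)
    ∨ˡ   : ∀ {φ ψ} → a ∈Ag φ → a ∈Ag (φ ∨' ψ)
    ∨ʳ   : ∀ {φ ψ} → a ∈Ag ψ → a ∈Ag (φ ∨' ψ)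
    ⇒ˡ   : ∀ {φ ψ} → a ∈Ag φ → a ∈Ag (φ ⇒ ψ)
    ⇒ʳ   : ∀ {φ ψ} → a ∈Ag ψ → a ∈Ag (φ ⇒ ψ)
    □here : ∀ {φ} → a ∈Ag (□ a φ)
    ◇here : ∀ {φ} → a ∈Ag (◇ a φ)
    □∈   : ∀ {b φ} → a ∈Ag φ → a ∈Ag (□ b φ)
    ◇∈   : ∀ {b φ} → a ∈Ag φ → a ∈Ag (◇ b φ)

  subst : (ℕ → Form Agent) → Form Agent → Form Agent
  subst σ (var p)  = σ p
  subst σ ⊥'       = ⊥'
  subst σ ⊤'       = ⊤'
  subst σ (¬' φ)   = ¬' subst σ φ
  subst σ (φ ∧' ψ) = subst σ φ ∧' subst σ ψ
  subst σ (φ ∨' ψ) = subst σ φ ∨' subst σ ψ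
  subst σ (φ ⇒ ψ)  = subst σ φ ⇒ subst σ ψ
  subst σ (□ a φ)  = □ a (subst σ φ)
  subst σ (◇ a φ)  = ◇ a (subst σ φ)

  -- Classical (Boolean) evaluation, treating modalised subformulas as
  -- propositional atoms: valuation V assigns truth values to atoms and to
  -- formulas of the form □_a φ, ◇_a φ.
  eval : (Form Agent → Bool) → Form Agent → Bool
  eval V (var p)  = V (var p)
  eval V ⊥'       = false
  eval V ⊤'       = true
  eval V (¬' φ)   = not (eval V φ)
  eval V (φ ∧' ψ) = eval V φ ∧ eval V ψ
  eval V (φ ∨' ψ) = eval V φ ∨ eval V ψ
  eval V (φ ⇒ ψ)  = not (eval V φ) ∨ eval V ψ
  eval V (□ a φ)  = V (□ a φ)
  eval V (◇ a φ)  = V (◇ a φ)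

  -- Classical tautology (substitution instance of a propositional tautology).
  Tautology : Form Agent → Set
  Tautology φ = ∀ (V : Form Agent → Bool) → eval V φ ≡ true

  record NormalModalLogic {ℓ : Level} (L : Form Agent → Set ℓ) : Set ℓ where
    field
      taut  : ∀ φ → Tautology φ → L φ
      K     : ∀ a φ ψ → L (□ a (φ ⇒ ψ) ⇒ (□ a φ ⇒ □ a ψ))
      dual  : ∀ a φ → L (◇ a φ ⇒ ¬' □ a (¬' φ))
      dual' : ∀ a φ → L (¬' □ a (¬' φ) ⇒ ◇ a φ)
      mp    : ∀ φ ψ → L φ → L (φ ⇒ ψ) → L ψ
      nec   : ∀ a φ → L φ → L (□ a φ)
      usubst : ∀ σ φ → L φ → L (subst σ φ)

  CraigInterpolation : {ℓ : Level} → (Form Agent → Set ℓ) → Set ℓ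
  CraigInterpolation L =
    ∀ φ ψ → L (φ ⇒ ψ) →
      Σ (Form Agent) λ δ →
        L (φ ⇒ δ) × L (δ ⇒ ψ)
        × (∀ p → p ∈Var δ → p ∈Var φ × p ∈Var ψ)
        × (∀ a → a ∈Ag δ → a ∈Ag φ × a ∈Ag ψ)

  data _⊢[_]_ {ℓ : Level} (φ : Form Agent) (L : Form Agent → Set ℓ) : Form Agent → Set ℓ where
    ax   : ∀ {ψ} → L ψ → φ ⊢[ L ] ψ
    hyp  : φ ⊢[ L ] φ
    mp   : ∀ {ψ χ} → φ ⊢[ L ] ψ → φ ⊢[ L ] (ψ ⇒ χ) → φ ⊢[ L ] χ
    nec  : ∀ {ψ} (a : Agent) → φ ⊢[ L ] ψ → φ ⊢[ L ] □ a ψ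

{-# OPTIONS --safe #-}
module Submission where

-- Global consequence reduces to local consequence from a bounded number of
-- modal iterates of the premise: φ ⊢_L ψ holds iff ⊢_L □≤ k φ ⇒ ψ for some k,
-- where □≤ k φ is the conjunction of all □_{a₁}⋯□_{aᵢ} φ with i ≤ k (a formula
-- because there are only finitely many agents).  Craig interpolation for
-- □≤ k φ ⇒ ψ then yields δ, whose atoms occur in φ because □≤ k φ has the atoms
-- of φ; its agents are only controlled by ψ, since □≤ k φ mentions every agent.

open import Defs
open import Level using (Level)
open import Data.Nat using (ℕ; zero; suc; _+_; _≤′_; ≤′-refl; ≤′-step)
open import Data.Nat.Properties using (m≤′m+n; n≤′m+n)
open import Data.Fin using (Fin)
open import Data.Bool using (true; false)
open import Data.Product using (Σ; ∃-syntax; _×_; _,_; proj₁; proj₂)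
open import Data.List using (List; []; _∷_)
open import Data.List.Relation.Unary.Any using (here; there)
open import Data.List.Membership.Propositional using (_∈_)
open import Data.List.Membership.Propositional.Properties using (∈-allFin)
open import Relation.Binary.PropositionalEquality using (refl)

module _ {Agent : Set} where

  ⇒-refl-taut : (A : Form Agent) → Tautology (A ⇒ A)
  ⇒-refl-taut A V with eval V A
  ... | true  = refl
  ... | false = refl

  ⇒-const-taut : (A B : Form Agent) → Tautology (A ⇒ B ⇒ A)
  ⇒-const-taut A B V with eval V A | eval V B
  ... | true  | true  = refl
  ... | true  | false = refl
  ... | false | _     = refl

  ⇒-trans-taut : (A B C : Form Agent) → Tautology ((A ⇒ B) ⇒ (B ⇒ C) ⇒ A ⇒ C)
  ⇒-trans-taut A B C V with eval V A | eval V B | eval V C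
  ... | true  | true  | true  = refl
  ... | true  | true  | false = refl
  ... | true  | false | _     = refl
  ... | false | true  | true  = refl
  ... | false | true  | false = refl
  ... | false | false | _     = refl

  ⇒-distrib-taut : (A B C : Form Agent) → Tautology ((A ⇒ B) ⇒ (A ⇒ B ⇒ C) ⇒ A ⇒ C)
  ⇒-distrib-taut A B C V with eval V A | eval V B | eval V C
  ... | true  | true  | true  = refl
  ... | true  | true  | false = refl
  ... | true  | false | _     = refl
  ... | false | _     | _     = refl

  ∧-proj₁-taut : (A B : Form Agent) → Tautology (A ∧' B ⇒ A)
  ∧-proj₁-taut A B V with eval V A | eval V B
  ... | true  | true  = refl
  ... | true  | false = refl
  ... | false | _     = refl

  ∧-proj₂-taut : (A B : Form Agent) → Tautology (A ∧' B ⇒ B)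
  ∧-proj₂-taut A B V with eval V A | eval V B
  ... | true  | true  = refl
  ... | true  | false = refl
  ... | false | _     = refl

  ∧-intro-taut : (A B : Form Agent) → Tautology (A ⇒ B ⇒ A ∧' B)
  ∧-intro-taut A B V with eval V A | eval V B
  ... | true  | true  = refl
  ... | true  | false = refl
  ... | false | _     = refl

  ∧-mono-taut : (A A′ B B′ : Form Agent) →
                Tautology ((A ⇒ A′) ⇒ (B ⇒ B′) ⇒ A ∧' B ⇒ A′ ∧' B′)
  ∧-mono-taut A A′ B B′ V with eval V A | eval V A′ | eval V B | eval V B′
  ... | true  | true  | true  | true  = refl
  ... | true  | true  | true  | false = refl
  ... | true  | true  | false | _     = refl
  ... | true  | false | _     | _     = refl
  ... | false | true  | true  | true  = refl
  ... | false | true  | true  | false = refl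
  ... | false | true  | false | _     = refl
  ... | false | false | true  | true  = refl
  ... | false | false | true  | false = refl
  ... | false | false | false | _     = refl

  everyone : List Agent → Form Agent → Form Agent
  everyone []       χ = ⊤'
  everyone (a ∷ as) χ = □ a χ ∧' everyone as χ

  □≤ : List Agent → ℕ → Form Agent → Form Agent
  □≤ as zero    φ = φ
  □≤ as (suc k) φ = φ ∧' everyone as (□≤ as k φ)

  ∈Var-everyone : ∀ {p} as χ → p ∈Var everyone as χ → p ∈Var χ
  ∈Var-everyone (a ∷ as) χ (∧ˡ (□∈ p∈χ)) = p∈χ
  ∈Var-everyone (a ∷ as) χ (∧ʳ p∈E)      = ∈Var-everyone as χ p∈E

  ∈Var-□≤ : ∀ {p} as k φ → p ∈Var □≤ as k φ → p ∈Var φ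
  ∈Var-□≤ as zero    φ p∈φ      = p∈φ
  ∈Var-□≤ as (suc k) φ (∧ˡ p∈φ) = p∈φ
  ∈Var-□≤ as (suc k) φ (∧ʳ p∈E) = ∈Var-□≤ as k φ (∈Var-everyone as _ p∈E)

module NormalLogic {Agent : Set} {ℓ : Level} {L : Form Agent → Set ℓ}
                   (isNormal : NormalModalLogic L) where

  open NormalModalLogic isNormal using (taut; K) renaming (mp to L-mp; nec to L-nec)

  private
    variable
      A B φ ψ : Form Agent

  ⇒-refl : ∀ {A} → L (A ⇒ A)
  ⇒-refl {A} = taut _ (⇒-refl-taut A)

  ⇒-const : ∀ {A B} → L A → L (B ⇒ A)
  ⇒-const {A} {B} ⊢A = L-mp _ _ ⊢A (taut _ (⇒-const-taut A B))

  ⇒-trans : ∀ {A B C} → L (A ⇒ B) → L (B ⇒ C) → L (A ⇒ C)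
  ⇒-trans {A} {B} {C} A⇒B B⇒C =
    L-mp _ _ B⇒C (L-mp _ _ A⇒B (taut _ (⇒-trans-taut A B C)))

  ⇒-distrib : ∀ {A B C} → L (A ⇒ B) → L (A ⇒ B ⇒ C) → L (A ⇒ C)
  ⇒-distrib {A} {B} {C} A⇒B A⇒B⇒C =
    L-mp _ _ A⇒B⇒C (L-mp _ _ A⇒B (taut _ (⇒-distrib-taut A B C)))

  ∧-proj₁ : ∀ {A B} → L (A ∧' B ⇒ A)
  ∧-proj₁ {A} {B} = taut _ (∧-proj₁-taut A B)

  ∧-proj₂ : ∀ {A B} → L (A ∧' B ⇒ B)
  ∧-proj₂ {A} {B} = taut _ (∧-proj₂-taut A B)

  ∧-mono : ∀ {A A′ B B′} → L (A ⇒ A′) → L (B ⇒ B′) → L (A ∧' B ⇒ A′ ∧' B′)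
  ∧-mono {A} {A′} {B} {B′} A⇒A′ B⇒B′ =
    L-mp _ _ B⇒B′ (L-mp _ _ A⇒A′ (taut _ (∧-mono-taut A A′ B B′)))

  □-mono : ∀ a → L (A ⇒ B) → L (□ a A ⇒ □ a B)
  □-mono {A} {B} a A⇒B = L-mp _ _ (L-nec a _ A⇒B) (K a A B)

  everyone-mono : ∀ as → L (A ⇒ B) → L (everyone as A ⇒ everyone as B)
  everyone-mono []       A⇒B = ⇒-refl
  everyone-mono (a ∷ as) A⇒B = ∧-mono (□-mono a A⇒B) (everyone-mono as A⇒B)

  everyone-elim : ∀ {a as} → a ∈ as → L (everyone as A ⇒ □ a A)
  everyone-elim (here refl)  = ∧-proj₁
  everyone-elim (there a∈as) = ⇒-trans ∧-proj₂ (everyone-elim a∈as)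

  □≤-step : ∀ as k → L (□≤ as (suc k) φ ⇒ □≤ as k φ)
  □≤-step as zero    = ∧-proj₁
  □≤-step as (suc k) = ∧-mono ⇒-refl (everyone-mono as (□≤-step as k))

  □≤-antitone : ∀ as {j k} → j ≤′ k → L (□≤ as k φ ⇒ □≤ as j φ)
  □≤-antitone as ≤′-refl           = ⇒-refl
  □≤-antitone as (≤′-step {k} j≤k) = ⇒-trans (□≤-step as k) (□≤-antitone as j≤k)

  □≤-elim : ∀ {a as} k → a ∈ as → L (□≤ as (suc k) φ ⇒ □ a (□≤ as k φ))
  □≤-elim k a∈as = ⇒-trans ∧-proj₂ (everyone-elim a∈as)

  ⊢-mpᴸ : φ ⊢[ L ] A → L (A ⇒ B) → φ ⊢[ L ] B
  ⊢-mpᴸ ⊢A A⇒B = mp ⊢A (ax A⇒B)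

  ⊢-∧ : φ ⊢[ L ] A → φ ⊢[ L ] B → φ ⊢[ L ] A ∧' B
  ⊢-∧ {A = A} {B = B} ⊢A ⊢B = mp ⊢B (⊢-mpᴸ ⊢A (taut _ (∧-intro-taut A B)))

  ⊢-everyone : ∀ as → φ ⊢[ L ] A → φ ⊢[ L ] everyone as A
  ⊢-everyone []       ⊢A = ax (taut ⊤' (λ _ → refl))
  ⊢-everyone (a ∷ as) ⊢A = ⊢-∧ (nec a ⊢A) (⊢-everyone as ⊢A)

  ⊢-□≤ : ∀ as k → φ ⊢[ L ] □≤ as k φ
  ⊢-□≤ as zero    = hyp
  ⊢-□≤ as (suc k) = ⊢-∧ hyp (⊢-everyone as (⊢-□≤ as k))

  local-deduction : ∀ {as} → (∀ a → a ∈ as) →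
                    φ ⊢[ L ] ψ → ∃[ k ] L (□≤ as k φ ⇒ ψ)
  local-deduction all∈ (ax ⊢ψ) = 0 , ⇒-const ⊢ψ
  local-deduction all∈ hyp     = 0 , ⇒-refl
  local-deduction {as = as} all∈ (mp ⊢A ⊢A⇒B)
    with local-deduction all∈ ⊢A | local-deduction all∈ ⊢A⇒B
  ... | j , □≤ʲ⇒A | k , □≤ᵏ⇒A⇒B =
    j + k , ⇒-distrib (⇒-trans (□≤-antitone as (m≤′m+n j k)) □≤ʲ⇒A)
                      (⇒-trans (□≤-antitone as (n≤′m+n j k)) □≤ᵏ⇒A⇒B)
  local-deduction all∈ (nec a ⊢A) with local-deduction all∈ ⊢A
  ... | k , □≤ᵏ⇒A = suc k , ⇒-trans (□≤-elim k (all∈ a)) (□-mono a □≤ᵏ⇒A)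

  deductive-interpolation :
    ∀ {as} → (∀ a → a ∈ as) → CraigInterpolation L →
    φ ⊢[ L ] ψ →
    Σ (Form Agent) λ δ →
      (φ ⊢[ L ] δ) × (δ ⊢[ L ] ψ)
      × (∀ p → p ∈Var δ → p ∈Var φ × p ∈Var ψ)
      × (∀ a → a ∈Ag δ → a ∈Ag ψ)
  deductive-interpolation {φ} {ψ} {as} all∈ craig φ⊢ψ
    with local-deduction all∈ φ⊢ψ
  ... | k , □≤ᵏ⇒ψ with craig (□≤ as k φ) ψ □≤ᵏ⇒ψ
  ... | δ , □≤ᵏ⇒δ , δ⇒ψ , vars , agents =
    δ , ⊢-mpᴸ (⊢-□≤ as k) □≤ᵏ⇒δ , ⊢-mpᴸ hyp δ⇒ψ
      , (λ p p∈δ → ∈Var-□≤ as k φ (proj₁ (vars p p∈δ)) , proj₂ (vars p p∈δ))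
      , (λ a a∈δ → proj₂ (agents a a∈δ))

proposition2 : (n : ℕ) (L : Form (Fin (suc n)) → Set) →
    NormalModalLogic L → CraigInterpolation L →
    ∀ φ ψ → φ ⊢[ L ] ψ →
    Σ (Form (Fin (suc n))) λ δ →
      (φ ⊢[ L ] δ) × (δ ⊢[ L ] ψ)
      × (∀ p → p ∈Var δ → p ∈Var φ × p ∈Var ψ)
      × (∀ a → a ∈Ag δ → a ∈Ag ψ)
proposition2 n L isNormal craig φ ψ =
  NormalLogic.deductive-interpolation isNormal (∈-allFin {n = suc n}) craig
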